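{- Let $k\ge2$ and let $\mathcal{F},\mathcal{G}$ be $k$-uniform hypergraphs. If $\mathcal{H}$ is an $n$-vertex $k$-uniform hypergraph whose edge set is the union of pairwise edge-disjoint $\mathcal{F}$-copies, then $\mathcal{H}$ contains at most $O(n^{v(\mathcal{G})-1})$ non-rainbow copies of $\mathcal{G}$, where the implied constant depends only on $\mathcal{F}$ and $\mathcal{G}$.
   Context: An $\mathcal{F}$-copy is a subhypergraph isomorphic to $\mathcal{F}$; each $\mathcal{F}$-copy in the decomposition of $\mathcal{H}$ is regarded as a single colour. A copy of $\mathcal{G}$ in $\mathcal{H}$ is rainbow if its edges come from pairwise distinct $\mathcal{F}$-copies, and non-rainbow otherwise. $v(\mathcal{G})$ is the number of vertices of $\mathcal{G}$. -}

module Defs where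

open import Data.Nat using (ℕ)
open import Data.Bool using (Bool)
open import Data.Fin using (Fin; _≟_)
open import Data.Fin.Subset using (Subset; _∈_; ∣_∣)
open import Data.Fin.Subset.Properties using (_∈?_)
open import Data.Fin.Properties using (any?)
open import Data.Vec using (tabulate)
open import Data.List using (List)
open import Data.List.Relation.Unary.All using (All)
open import Data.List.Relation.Unary.Any using (Any)
open import Data.List.Relation.Unary.AllPairs using (AllPairs)
open import Data.List.Relation.Unary.Unique.Propositional using (Unique)
import Data.List.Membership.Propositional as LM
open import Data.Product using (Σ; ∃; _×_; _,_)
open import Relation.Nullary using (¬_; does)
open import Relation.Nullary.Decidable using (_×-dec_)
open import Relation.Binary.PropositionalEquality using (_≡_; _≢_)
open import Function.Definitions using (Injective)
open import Function.Bundles using (_⇔_)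

-- A k-uniform hypergraph on the vertex set Fin m (so v = m):
-- a duplicate-free list of edges, each a k-element subset of Fin m.
record Hypergraph (k m : ℕ) : Set where
  field
    edges    : List (Subset m)
    uniform  : All (λ e → ∣ e ∣ ≡ k) edges
    distinct : Unique edges
open Hypergraph public

_∈E_ : ∀ {k m} → Subset m → Hypergraph k m → Set
e ∈E H = e LM.∈ edges H

image : ∀ {a n} → (Fin a → Fin n) → Subset a → Subset n
image φ e = tabulate (λ x → does (any? (λ i → (i ∈? e) ×-dec (φ i ≟ x))))

-- Its image (vertex image together with the images of the edges of G) is a
-- copy of G in H, i.e. a subhypergraph of H isomorphic to G.
record Embedding {k g n : ℕ} (G : Hypergraph k g) (H : Hypergraph k n) : Set where
  field
    map       : Fin g → Fin n
    injective : Injective _≡_ _≡_ map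
    preserves : ∀ e → e ∈E G → image map e ∈E H
open Embedding public

InCopy : ∀ {k g n} {G : Hypergraph k g} {H : Hypergraph k n} →
         Embedding G H → Subset n → Set
InCopy {G = G} φ e = ∃ λ f → f ∈E G × image (map φ) f ≡ e

SameCopy : ∀ {k g n} {G : Hypergraph k g} {H : Hypergraph k n} →
           Embedding G H → Embedding G H → Set
SameCopy {n = n} φ ψ =
  ((x : Fin n) → (∃ λ i → map φ i ≡ x) ⇔ (∃ λ i → map ψ i ≡ x)) ×
  ((e : Subset n) → InCopy φ e ⇔ InCopy ψ e)

EdgeDisjoint : ∀ {k f n} {F : Hypergraph k f} {H : Hypergraph k n} →
               Embedding F H → Embedding F H → Set
EdgeDisjoint {n = n} φ ψ = (e : Subset n) → InCopy φ e → ¬ InCopy ψ e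

-- D is a decomposition of E(H) into pairwise edge-disjoint F-copies:
-- the copies are pairwise edge-disjoint and every edge of H lies in one of them.
-- (Each copy is contained in H since embeddings preserve edges.)
record Decomposition {k f n : ℕ} (F : Hypergraph k f) (H : Hypergraph k n)
                     (D : List (Embedding F H)) : Set where
  field
    disjoint : AllPairs EdgeDisjoint D
    covers   : ∀ e → e ∈E H → Any (λ ψ → InCopy ψ e) D

NonRainbow : ∀ {k f g n} {F : Hypergraph k f} {G : Hypergraph k g} {H : Hypergraph k n} →
             List (Embedding F H) → Embedding G H → Set
NonRainbow {G = G} D φ =
  ∃ λ e₁ → ∃ λ e₂ → e₁ ∈E G × e₂ ∈E G × e₁ ≢ e₂ ×
    Any (λ ψ → InCopy ψ (image (map φ) e₁) × InCopy ψ (image (map φ) e₂)) D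

-- A non-rainbow copy φ of G has two distinct edges a, b lying in one F-copy ψ of the
-- decomposition; pick a vertex v of G in b but not in a. Since the F-copies are
-- edge-disjoint, ψ is the only one containing the edge φ(a), so ψ is determined by φ
-- restricted to V(G) ∖ {v}, and then φ(v) is one of the f vertices of ψ. Hence φ is
-- determined by the edge a, the vertex v, a vertex of F and the values of φ on the
-- other g − 1 vertices: at most e(G) · g · f · n^(g−1) copies.
module Submission where

open import Defs
open import Data.Nat using (ℕ; _≤_; _*_; _^_; _∸_; zero; suc; z≤n; s≤s; _≤?_)
open import Data.Nat.Properties using (≰⇒>)
open import Data.Bool using (true)
open import Data.Empty using (⊥-elim)
open import Data.Fin using (Fin; zero; suc; _<_; combine; punchIn; punchOut; funToFin; finToFun)
  renaming (_≟_ to _≟ᶠ_)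
open import Data.Fin.Properties using (any?; combine-injective; pigeonhole; punchIn-punchOut; finToFun-funToFin)
open import Data.Fin.Subset using (Subset; _∈_; _∉_; _⊆_)
open import Data.Fin.Subset.Properties using (_∈?_; _⊆?_; ⊆-antisym)
open import Data.List using (List; []; _∷_; length; lookup)
open import Data.List.Membership.Propositional using (find) renaming (_∈_ to _∈ₗ_)
open import Data.List.Membership.Propositional.Properties using (∈-lookup)
open import Data.List.Membership.Setoid.Properties using (index-injective)
open import Data.List.Relation.Unary.All as All using (All; []; _∷_)
open import Data.List.Relation.Unary.AllPairs using (AllPairs; []; _∷_)
open import Data.List.Relation.Unary.Any using (here; there; index)
open import Data.Product using (∃; _×_; _,_)
open import Data.Sum using (_⊎_; inj₁; inj₂)
open import Data.Vec using ([])
open import Data.Vec.Properties using (lookup∘tabulate; tabulate-cong; []=⇒lookup; lookup⇒[]=)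
open import Function.Base using (_∘_)
open import Function.Bundles using (mk⇔)
open import Relation.Binary.PropositionalEquality
open import Relation.Nullary using (¬_; Dec; does; yes; no; ¬?)
open import Relation.Nullary.Decidable using (_×-dec_; dec-true; does-⇔; decidable-stable)

does-true⇒ : {A : Set} (a? : Dec A) → does a? ≡ true → A
does-true⇒ (yes a) _ = a

∈-image⁺ : ∀ {a n} (φ : Fin a → Fin n) {e i} → i ∈ e → φ i ∈ image φ e
∈-image⁺ φ {e} {i} i∈e = lookup⇒[]= (φ i) (image φ e)
  (trans (lookup∘tabulate _ (φ i)) (dec-true (any? _) (i , i∈e , refl)))

∈-image⁻ : ∀ {a n} (φ : Fin a → Fin n) {e x} → x ∈ image φ e → ∃ λ i → i ∈ e × φ i ≡ x
∈-image⁻ φ {e} {x} x∈φe =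
  does-true⇒ (any? _) (trans (sym (lookup∘tabulate _ x)) ([]=⇒lookup x∈φe))

image-cong : ∀ {a n} {φ ψ : Fin a → Fin n} e → (∀ {i} → i ∈ e → φ i ≡ ψ i) → image φ e ≡ image ψ e
image-cong {φ = φ} {ψ} e φ≡ψ = tabulate-cong λ x → does-⇔
  (mk⇔ (λ (i , i∈e , φi≡x) → i , i∈e , trans (sym (φ≡ψ i∈e)) φi≡x)
       (λ (i , i∈e , ψi≡x) → i , i∈e , trans (φ≡ψ i∈e) ψi≡x))
  (any? λ i → (i ∈? e) ×-dec (φ i ≟ᶠ x)) (any? λ i → (i ∈? e) ×-dec (ψ i ≟ᶠ x))

⊈⇒∃-∈-∉ : ∀ {n} {a b : Subset n} → ¬ a ⊆ b → ∃ λ v → v ∈ a × v ∉ b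
⊈⇒∃-∈-∉ {a = a} {b} a⊈b with any? (λ v → (v ∈? a) ×-dec ¬? (v ∈? b))
... | yes witness = witness
... | no none = ⊥-elim (a⊈b λ {v} v∈a → decidable-stable (v ∈? b) (λ v∉b → none (v , v∈a , v∉b)))

≢⇒∃-∈-∉ : ∀ {n} {a b : Subset n} → a ≢ b → (∃ λ v → v ∈ a × v ∉ b) ⊎ (∃ λ v → v ∈ b × v ∉ a)
≢⇒∃-∈-∉ {a = a} {b} a≢b with a ⊆? b | b ⊆? a
... | no a⊈b  | _        = inj₁ (⊈⇒∃-∈-∉ a⊈b)
... | yes _   | no b⊈a   = inj₂ (⊈⇒∃-∈-∉ b⊈a)
... | yes a⊆b | yes b⊆a  = ⊥-elim (a≢b (⊆-antisym a⊆b b⊆a))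

Subset-0-unique : (a b : Subset 0) → a ≡ b
Subset-0-unique [] [] = refl

funToFin-injective : ∀ {m n} {φ ψ : Fin m → Fin n} → funToFin φ ≡ funToFin ψ → ∀ i → φ i ≡ ψ i
funToFin-injective {φ = φ} {ψ} eq i = begin
  φ i                        ≡⟨ finToFun-funToFin φ i ⟨
  finToFun (funToFin φ) i    ≡⟨ cong (λ c → finToFun c i) eq ⟩
  finToFun (funToFin ψ) i    ≡⟨ finToFun-funToFin ψ i ⟩
  ψ i                        ∎
  where open ≡-Reasoning

agree-off-punchIn : ∀ {m} {A : Set} {φ ψ : Fin (suc m) → A} v →
  (∀ i → φ (punchIn v i) ≡ ψ (punchIn v i)) → ∀ {x} → v ≢ x → φ x ≡ ψ x
agree-off-punchIn {φ = φ} {ψ} v agree v≢x =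
  subst (λ y → φ y ≡ ψ y) (punchIn-punchOut v≢x) (agree (punchOut v≢x))

AllPairs-lookup : ∀ {A : Set} {R : A → A → Set} {xs : List A} → AllPairs R xs →
  ∀ {i j} → i < j → R (lookup xs i) (lookup xs j)
AllPairs-lookup (Rx ∷ _)     {zero}  {suc j} _         = All.lookup Rx (∈-lookup j)
AllPairs-lookup (_ ∷ Rpairs) {suc i} {suc j} (s≤s i<j) = AllPairs-lookup Rpairs i<j

length≤-by-code : ∀ {A : Set} {P : A → Set} {R : A → A → Set} {N} (code : ∀ {x} → P x → Fin N) →
  (∀ {x y} (px : P x) (py : P y) → code px ≡ code py → ¬ R x y) →
  ∀ {xs} → All P xs → AllPairs R xs → length xs ≤ N
length≤-by-code {N = N} code collision {xs} Ps Rpairs with length xs ≤? N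
... | yes xs≤N = xs≤N
... | no xs≰N with pigeonhole (≰⇒> xs≰N) (λ i → code (All.lookup Ps (∈-lookup i)))
...   | i , j , i<j , same-code = ⊥-elim (collision _ _ same-code (AllPairs-lookup Rpairs i<j))

module _ {k a n : ℕ} {A : Hypergraph k a} {H : Hypergraph k n} where

  InCopy-unique : ∀ {D : List (Embedding A H)} {ψ ψ′ : Embedding A H} {e} → AllPairs EdgeDisjoint D →
    ψ ∈ₗ D → ψ′ ∈ₗ D → InCopy ψ e → InCopy ψ′ e → ψ ≡ ψ′
  InCopy-unique (_ ∷ _)         (here refl) (here refl)  _  _   = refl
  InCopy-unique (disjoint ∷ _)  (here refl) (there ψ′∈D) e∈ψ e∈ψ′ = ⊥-elim (All.lookup disjoint ψ′∈D _ e∈ψ e∈ψ′)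
  InCopy-unique (disjoint ∷ _)  (there ψ∈D) (here refl)  e∈ψ e∈ψ′ = ⊥-elim (All.lookup disjoint ψ∈D _ e∈ψ′ e∈ψ)
  InCopy-unique (_ ∷ disjoint)  (there ψ∈D) (there ψ′∈D) e∈ψ e∈ψ′ = InCopy-unique disjoint ψ∈D ψ′∈D e∈ψ e∈ψ′

  ≗⇒SameCopy : ∀ (φ ψ : Embedding A H) → (∀ i → map φ i ≡ map ψ i) → SameCopy φ ψ
  ≗⇒SameCopy φ ψ φ≗ψ =
    (λ x → mk⇔ (λ (i , φi≡x) → i , trans (sym (φ≗ψ i)) φi≡x)
               (λ (i , ψi≡x) → i , trans (φ≗ψ i) ψi≡x)) ,
    (λ e → mk⇔ (λ (b , b∈A , φb≡e) → b , b∈A , trans (sym (image-cong b λ {i} _ → φ≗ψ i)) φb≡e)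
               (λ (b , b∈A , ψb≡e) → b , b∈A , trans (image-cong b λ {i} _ → φ≗ψ i) ψb≡e))

module _ {k f g n : ℕ} {F : Hypergraph k f} {G : Hypergraph k (suc g)} {H : Hypergraph k n}
         (D : List (Embedding F H)) where

  record Certificate (φ : Embedding G H) : Set where
    constructor certificate
    field
      edge          : Subset (suc g)
      edge∈G        : edge ∈E G
      apex          : Fin (suc g)
      apex∉edge     : apex ∉ edge
      copy          : Embedding F H
      copy∈D        : copy ∈ₗ D
      edge-in-copy  : InCopy copy (image (map φ) edge)
      apex-preimage : Fin f
      apex-in-copy  : map copy apex-preimage ≡ map φ apex

  open Certificate

  certify : ∀ {φ} {a b : Subset (suc g)} {ψ : Embedding F H} → a ∈E G → ψ ∈ₗ D →
    InCopy ψ (image (map φ) a) → InCopy ψ (image (map φ) b) → ∀ {v} → v ∈ b → v ∉ a → Certificate φ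
  certify {φ} {ψ = ψ} a∈G ψ∈D a-in-ψ (c , _ , ψc≡φb) {v} v∈b v∉a
    with j , _ , ψj≡φv ← ∈-image⁻ (map ψ) (subst (map φ v ∈_) (sym ψc≡φb) (∈-image⁺ (map φ) v∈b))
    = record { edge∈G = a∈G ; apex∉edge = v∉a ; copy∈D = ψ∈D ; edge-in-copy = a-in-ψ ; apex-in-copy = ψj≡φv }

  nonRainbow⇒Certificate : ∀ {φ} → NonRainbow D φ → Certificate φ
  nonRainbow⇒Certificate (e₁ , e₂ , e₁∈G , e₂∈G , e₁≢e₂ , shared)
    with ψ , ψ∈D , e₁-in-ψ , e₂-in-ψ ← find shared
    with ≢⇒∃-∈-∉ e₁≢e₂
  ... | inj₁ (v , v∈e₁ , v∉e₂) = certify e₂∈G ψ∈D e₂-in-ψ e₁-in-ψ v∈e₁ v∉e₂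
  ... | inj₂ (v , v∈e₂ , v∉e₁) = certify e₁∈G ψ∈D e₁-in-ψ e₂-in-ψ v∈e₂ v∉e₁

  code : ∀ {φ} → Certificate φ → Fin (length (edges G) * (suc g * f) * n ^ g)
  code {φ} c = combine (combine (index (edge∈G c)) (combine (apex c) (apex-preimage c)))
                       (funToFin (map φ ∘ punchIn (apex c)))

  code-injective : AllPairs EdgeDisjoint D → ∀ {φ φ′} (c : Certificate φ) (c′ : Certificate φ′) →
    code c ≡ code c′ → ∀ x → map φ x ≡ map φ′ x
  code-injective disjoint {φ} {φ′}
    (certificate a a∈G v v∉a ψ ψ∈D a-in-ψ j ψj≡φv) (certificate a′ a′∈G v′ _ ψ′ ψ′∈D a′-in-ψ′ j′ ψ′j′≡φ′v′)
    same-code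
    with same-edge-apex , same-rest ← combine-injective _ _ _ _ same-code
    with same-edge , same-apex-preimage ← combine-injective _ _ _ _ same-edge-apex
    with refl , refl ← combine-injective v j v′ j′ same-apex-preimage
    with refl ← index-injective (setoid _) a∈G a′∈G same-edge
    = agree
    where
      agree-off-apex : ∀ {x} → v ≢ x → map φ x ≡ map φ′ x
      agree-off-apex = agree-off-punchIn v (funToFin-injective same-rest)

      same-copy : ψ ≡ ψ′
      same-copy = InCopy-unique disjoint ψ∈D ψ′∈D a-in-ψ
        (subst (InCopy ψ′) (sym (image-cong a λ {i} i∈a → agree-off-apex {i} λ { refl → v∉a i∈a })) a′-in-ψ′)

      agree : ∀ x → map φ x ≡ map φ′ x
      agree x with v ≟ᶠ x
      ... | yes refl = begin
        map φ v     ≡⟨ ψj≡φv ⟨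
        map ψ j     ≡⟨ cong (λ χ → map χ j) same-copy ⟩
        map ψ′ j    ≡⟨ ψ′j′≡φ′v′ ⟩
        map φ′ v    ∎
        where open ≡-Reasoning
      ... | no v≢x = agree-off-apex v≢x

¬NonRainbow-without-vertices : ∀ {k f n} {F : Hypergraph k f} {G : Hypergraph k 0} {H : Hypergraph k n}
  (D : List (Embedding F H)) (φ : Embedding G H) → ¬ NonRainbow D φ
¬NonRainbow-without-vertices D φ (e₁ , e₂ , _ , _ , e₁≢e₂ , _) = e₁≢e₂ (Subset-0-unique e₁ e₂)

nonRainbow-copies-bound : ∀ {k f g n} {F : Hypergraph k f} {G : Hypergraph k g} {H : Hypergraph k n}
  (D : List (Embedding F H)) → AllPairs EdgeDisjoint D →
  (L : List (Embedding G H)) → All (NonRainbow D) L → AllPairs (λ φ ψ → ¬ SameCopy φ ψ) L →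
  length L ≤ length (edges G) * (g * f) * n ^ (g ∸ 1)
nonRainbow-copies-bound {g = zero} D _ [] _ _ = z≤n
nonRainbow-copies-bound {g = zero} D _ (φ ∷ _) (nonRainbow ∷ _) _ =
  ⊥-elim (¬NonRainbow-without-vertices D φ nonRainbow)
nonRainbow-copies-bound {g = suc g} {G = G} D disjoint L nonRainbow distinct =
  length≤-by-code {P = Certificate {G = G} D} (code D)
    (λ {φ} {φ′} c c′ same-code ¬same → ¬same (≗⇒SameCopy φ φ′ (code-injective D disjoint c c′ same-code)))
    (All.map (nonRainbow⇒Certificate D) nonRainbow) distinct

lemma3p3 : (k : ℕ) → 2 ≤ k → {f g : ℕ} (F : Hypergraph k f) (G : Hypergraph k g) →
    ∃ λ (C : ℕ) → (n : ℕ) (H : Hypergraph k n) (D : List (Embedding F H)) →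
      Decomposition F H D →
      (L : List (Embedding G H)) →
      All (NonRainbow D) L →
      AllPairs (λ φ ψ → ¬ SameCopy φ ψ) L →
      length L ≤ C * n ^ (g ∸ 1)
lemma3p3 k _ {f} {g} F G = length (edges G) * (g * f) ,
  λ n H D decomposition → nonRainbow-copies-bound D (Decomposition.disjoint decomposition)
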